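{- For any formula $\varphi$ of $\mathcal{PCO}_{\sigma}$ and any \emph{nonempty} causal multiteam $T$ of signature $\sigma$, \[ T\models \varphi^C \iff T\not\models \varphi. \]
   Context: A signature $\sigma=(Dom,Ran)$ is a finite set $Dom$ of variables, each with a finite range $Ran(X)$. A causal multiteam $T=(T^-,\mathcal{F})$ of signature $\sigma$ consists of a finite multiset $T^-$ of assignments over $Dom$ (formally, assignments extended by an extra variable $Key$ taking distinct values on distinct rows) and a function component $\mathcal{F}$ assigning to each endogenous variable $Y$ a non-constant function $\mathcal{F}_Y$ of the remaining variables $\mathbf W_Y$, such that $s(Y)=\mathcal{F}_Y(s(\mathbf W_Y))$ for all $s\in T^-$. $T$ is empty if $T^-$ is empty. For a consistent conjunction $\mathbf X=\mathbf x$, the intervened causal multiteam $T_{\mathbf X=\mathbf x}$ (for recursive, i.e. acyclic, $T$) is obtained by setting $\mathbf X$ to $\mathbf x$ in every row, recomputing the descendants of $\mathbf X$ via $\mathcal{F}$, and deleting the functions $\mathcal{F}_X$ for $X\in\mathbf X$; interventions preserve the number of rows. The language $\mathcal{CO}$: $\alpha ::= Y=y \mid Y\neq y \mid \alpha\land\alpha \mid \alpha\lor\alpha \mid \alpha\supset\alpha \mid \mathbf X=\mathbf x \mathrel{\Box\!\!\rightarrow} \alpha$, with $\mathrel{\Box\!\!\rightarrow}$ the interventionist counterfactual. Semantics: $T\models Y=y$ (resp. $Y\neq y$) iff every $s\in T^-$ has $s(Y)=y$ (resp. $\neq y$); $\land$ is conjunction; $T\models\alpha\lor\beta$ iff $T^-$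 is the union of the multiteam components of two causal sub-multiteams (same $\mathcal{F}$) satisfying $\alpha$ and $\beta$ respectively; $T^\alpha$ is the sub-multiteam of rows $s$ with $(\{s\},\mathcal{F})\models\alpha$, and $T\models\alpha\supset\beta$ iff $T^\alpha\models\beta$; $T\models \mathbf X=\mathbf x\mathrel{\Box\!\!\rightarrow}\psi$ iff $T_{\mathbf X=\mathbf x}\models\psi$ or $\mathbf X=\mathbf x$ is inconsistent. For nonempty $T$, $P_T(\alpha)=|(T^\alpha)^-|/|T^-|$. The language $\mathcal{PCO}$: $\varphi ::= \eta \mid \varphi\land\varphi \mid \varphi\sqcup\varphi \mid \alpha\supset\varphi \mid \mathbf X=\mathbf x\mathrel{\Box\!\!\rightarrow}\varphi$, where $\alpha,\beta\in\mathcal{CO}$ and atoms $\eta$ are literals or probabilistic atoms $\Pr(\alpha)\geq\epsilon$, $\Pr(\alpha)>\epsilon$, $\Pr(\alpha)\geq\Pr(\beta)$, $\Pr(\alpha)>\Pr(\beta)$ ($\epsilon\in[0,1]\cap\mathbb Q$). $T\models\psi\sqcup\chi$ iff $T\models\psi$ or $T\models\chi$; a probabilistic atom holds in $T$ iff $T$ is empty or the corresponding inequality between values of $P_T$ holds. Abbreviations: $\Pr(\alpha)\leq\epsilon$ is $\Pr(\neg\alpha)\geq 1-\epsilon$, $\Pr(\alpha)<\epsilon$ is $\Pr(\neg\alpha)>1-\epsilon$ (with $\neg$ the dual negation, behaving classically on single rows), $\Pr(\alpha)=\epsilon$ and $\Pr(\alpha)\neq\epsilon$ as expected, $\bot$ is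 $X=x\mathrel{\Box\!\!\rightarrow} X\neq x$, $\top$ is $X=x\mathrel{\Box\!\!\rightarrow}X=x$. The weak contradictory negation $\varphi^C$ is defined inductively: $(\Pr(\alpha)\geq\epsilon)^C$ is $\Pr(\alpha)<\epsilon$ and vice versa; $(\Pr(\alpha)>\epsilon)^C$ is $\Pr(\alpha)\leq\epsilon$ and vice versa; $(\Pr(\alpha)=\epsilon)^C$ is $\Pr(\alpha)\neq\epsilon$ and vice versa; $\bot^C$ is $\top$ and vice versa; $(X=x)^C$ is $\Pr(X=x)<1$; $(X\neq x)^C$ is $\Pr(X\neq x)<1$; $(\psi\land\chi)^C$ is $\psi^C\sqcup\chi^C$; $(\psi\sqcup\chi)^C$ is $\psi^C\land\chi^C$; $(\alpha\supset\chi)^C$ is $\Pr(\alpha)>0\land(\alpha\supset\chi^C)$; $(\mathbf X=\mathbf x\mathrel{\Box\!\!\rightarrow}\chi)^C$ is $\mathbf X=\mathbf x\mathrel{\Box\!\!\rightarrow}\chi^C$. -}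

module Defs where

open import Data.Nat using (ℕ; zero; suc; _∸_; _≤_; _<_)
open import Data.Nat.Properties using (m∸n≤m)
open import Data.Integer using (+_)
open import Data.Rational as ℚ using (ℚ)
open import Data.Fin using (Fin; zero; suc; _≟_)
open import Data.Bool using (Bool; true; false; _∨_; _∧_; if_then_else_)
open import Data.Maybe using (Maybe; just; nothing; is-just)
open import Data.List using (List; []; _∷_; [_]; length; lookup; map; allFin)
open import Data.Bool.ListAction using (any)
open import Data.List.Relation.Unary.All using (All)
open import Data.List.Membership.Propositional using (_∈_)
open import Data.Product using (Σ; ∃₂; _×_; _,_)
open import Data.Unit using (⊤)
open import Relation.Binary.PropositionalEquality using (_≡_; _≢_; refl)
open import Relation.Nullary using (yes; no)

-- A signature: n variables (Fin n), variable X has the finite range Fin (ran X).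
record Signature : Set where
  field
    n   : ℕ
    ran : Fin n → ℕ

-- ε ∈ [0,1] ∩ ℚ, presented as num / (suc den-1) with num ≤ suc den-1.
record Eps : Set where
  field
    num   : ℕ
    den-1 : ℕ
    bound : num ≤ suc den-1

valε : Eps → ℚ
valε ε = (+ Eps.num ε) ℚ./ suc (Eps.den-1 ε)

one-minus : Eps → Eps
one-minus ε = record { num = suc (Eps.den-1 ε) ∸ Eps.num ε ; den-1 = Eps.den-1 ε
                     ; bound = m∸n≤m (suc (Eps.den-1 ε)) (Eps.num ε) }

ε0 : Eps
ε0 = record { num = 0 ; den-1 = 0 ; bound = Data.Nat.z≤n }

ε1 : Eps
ε1 = record { num = 1 ; den-1 = 0 ; bound = Data.Nat.s≤s Data.Nat.z≤n }

-- Sub-multiteams: rows are identified by their position (the Key); a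
-- sub-multiteam is given by a set of positions.
select : {A : Set} (xs : List A) → (Fin (length xs) → Bool) → List A
select []       S = []
select (x ∷ xs) S with S zero
... | true  = x ∷ select xs (λ i → S (suc i))
... | false = select xs (λ i → S (suc i))

module Causal (σ : Signature) where
  open Signature σ

  Var : Set
  Var = Fin n

  Val : Var → Set
  Val X = Fin (ran X)

  Assign : Set
  Assign = (X : Var) → Val X

  record Mechanism (Y : Var) : Set where
    field
      parents  : Var → Bool
      notSelf  : parents Y ≡ false
      fun      : Assign → Val Y
      onlyPa   : ∀ s s' → (∀ X → parents X ≡ true → s X ≡ s' X) → fun s ≡ fun s'
      nonconst : ∃₂ λ s s' → fun s ≢ fun s'

  -- nothing = exogenous variable
  FunComp : Set
  FunComp = (Y : Var) → Maybe (Mechanism Y)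

  Compatible : FunComp → Assign → Set
  Compatible F s = ∀ Y m → F Y ≡ just m → s Y ≡ Mechanism.fun m s

  record CausalMultiteam : Set where
    field
      rows   : List Assign
      F      : FunComp
      compat : All (Compatible F) rows

  NonEmpty : CausalMultiteam → Set
  NonEmpty T = CausalMultiteam.rows T ≢ []

  -- recursive = the causal graph (edges X → Y for X ∈ W_Y) is acyclic,
  -- witnessed by a ranking of the variables along which edges increase.
  Recursive : FunComp → Set
  Recursive F = Σ (Var → ℕ) λ rank →
    ∀ Y m X → F Y ≡ just m → Mechanism.parents m X ≡ true → rank X < rank Y

  Consistent : List (Σ Var Val) → Set
  Consistent eqs = ∀ X (v v' : Val X) → (X , v) ∈ eqs → (X , v') ∈ eqs → v ≡ v'

  record Intervention : Set where
    field
      eqs        : List (Σ Var Val)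
      consistent : Consistent eqs

  lookupI : List (Σ Var Val) → (X : Var) → Maybe (Val X)
  lookupI []             X = nothing
  lookupI ((Y , v) ∷ es) X with Y ≟ X
  ... | yes refl = just v
  ... | no _     = lookupI es X

  inI : Intervention → Var → Bool
  inI ι X = is-just (lookupI (Intervention.eqs ι) X)

  anyVar : (Var → Bool) → Bool
  anyVar p = any p (allFin n)

  reach : FunComp → Intervention → ℕ → Var → Bool
  reach F ι zero    Y = inI ι Y
  reach F ι (suc k) Y with F Y
  ... | nothing = reach F ι k Y
  ... | just m  = reach F ι k Y ∨ anyVar (λ X → Mechanism.parents m X ∧ reach F ι k X)

  -- descendants of X (together with X itself)
  Desc : FunComp → Intervention → Var → Bool
  Desc F ι = reach F ι n

  stepRow : FunComp → Intervention → Assign → Assign → Assign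
  stepRow F ι s cur Y with lookupI (Intervention.eqs ι) Y
  ... | just v  = v
  ... | nothing with F Y | Desc F ι Y
  ...   | just m  | true = Mechanism.fun m cur
  ...   | _       | _    = s Y

  iter : ℕ → (Assign → Assign) → Assign → Assign
  iter zero    f a = a
  iter (suc k) f a = f (iter k f a)

  -- the intervened row; for recursive F, n rounds of recomputation in the
  -- causal order reach the (unique) solution
  intRow : FunComp → Intervention → Assign → Assign
  intRow F ι s = iter n (stepRow F ι s) s

  intF : FunComp → Intervention → FunComp
  intF F ι Y with lookupI (Intervention.eqs ι) Y
  ... | just _  = nothing
  ... | nothing = F Y

  infixr 6 _∧̇_ _∨̇_
  infixr 5 _⊃̇_ _□→_
  data CO : Set where
    _≐_  : (Y : Var) → Val Y → CO
    _≠̇_  : (Y : Var) → Val Y → CO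
    _∧̇_  : CO → CO → CO
    _∨̇_  : CO → CO → CO
    _⊃̇_  : CO → CO → CO
    _□→_ : Intervention → CO → CO

  ¬̇ : CO → CO
  ¬̇ (Y ≐ y)  = Y ≠̇ y
  ¬̇ (Y ≠̇ y)  = Y ≐ y
  ¬̇ (α ∧̇ β)  = ¬̇ α ∨̇ ¬̇ β
  ¬̇ (α ∨̇ β)  = ¬̇ α ∧̇ ¬̇ β
  ¬̇ (α ⊃̇ β)  = α ∧̇ ¬̇ β
  ¬̇ (ι □→ α) = ι □→ ¬̇ α

  Sub : List Assign → Set
  Sub rows = Fin (length rows) → Bool

  satCO : FunComp → List Assign → CO → Set
  IsRestr : FunComp → (rows : List Assign) → CO → Sub rows → Set

  satCO F rows (Y ≐ y)  = All (λ s → s Y ≡ y) rows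
  satCO F rows (Y ≠̇ y)  = All (λ s → s Y ≢ y) rows
  satCO F rows (α ∧̇ β)  = satCO F rows α × satCO F rows β
  satCO F rows (α ∨̇ β)  = Σ (Sub rows) λ S₁ → Σ (Sub rows) λ S₂ →
    (∀ i → (S₁ i ∨ S₂ i) ≡ true) × satCO F (select rows S₁) α × satCO F (select rows S₂) β
  satCO F rows (α ⊃̇ β)  = Σ (Sub rows) λ S → IsRestr F rows α S × satCO F (select rows S) β
  satCO F rows (ι □→ α) = satCO (intF F ι) (map (intRow F ι) rows) α

  IsRestr F rows α S = ∀ i → (S i ≡ true → satCO F [ lookup rows i ] α)
                           × (satCO F [ lookup rows i ] α → S i ≡ true)

  infixr 6 _∧ᵖ_ _⊔_
  infixr 5 _⊃ᵖ_ _□→ᵖ_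
  data PCO : Set where
    lit=   : (Y : Var) → Val Y → PCO
    lit≠   : (Y : Var) → Val Y → PCO
    Pr≥    : CO → Eps → PCO
    Pr>    : CO → Eps → PCO
    Pr≥Pr  : CO → CO → PCO
    Pr>Pr  : CO → CO → PCO
    _∧ᵖ_   : PCO → PCO → PCO
    _⊔_    : PCO → PCO → PCO
    _⊃ᵖ_   : CO → PCO → PCO
    _□→ᵖ_  : Intervention → PCO → PCO

  Pr≤ : CO → Eps → PCO
  Pr≤ α ε = Pr≥ (¬̇ α) (one-minus ε)

  Pr< : CO → Eps → PCO
  Pr< α ε = Pr> (¬̇ α) (one-minus ε)

  satP : FunComp → List Assign → PCO → Set
  satP F rows (lit= Y y) = All (λ s → s Y ≡ y) rows
  satP F rows (lit≠ Y y) = All (λ s → s Y ≢ y) rows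
  satP F []         (Pr≥ α ε) = ⊤
  satP F (r ∷ rs)   (Pr≥ α ε) = Σ (Sub (r ∷ rs)) λ S → IsRestr F (r ∷ rs) α S ×
    (valε ε ℚ.≤ (+ length (select (r ∷ rs) S)) ℚ./ suc (length rs))
  satP F []         (Pr> α ε) = ⊤
  satP F (r ∷ rs)   (Pr> α ε) = Σ (Sub (r ∷ rs)) λ S → IsRestr F (r ∷ rs) α S ×
    (valε ε ℚ.< (+ length (select (r ∷ rs) S)) ℚ./ suc (length rs))
  satP F []         (Pr≥Pr α β) = ⊤
  satP F (r ∷ rs)   (Pr≥Pr α β) = Σ (Sub (r ∷ rs)) λ S₁ → Σ (Sub (r ∷ rs)) λ S₂ →
    IsRestr F (r ∷ rs) α S₁ × IsRestr F (r ∷ rs) β S₂ ×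
    ((+ length (select (r ∷ rs) S₂)) ℚ./ suc (length rs)
       ℚ.≤ (+ length (select (r ∷ rs) S₁)) ℚ./ suc (length rs))
  satP F []         (Pr>Pr α β) = ⊤
  satP F (r ∷ rs)   (Pr>Pr α β) = Σ (Sub (r ∷ rs)) λ S₁ → Σ (Sub (r ∷ rs)) λ S₂ →
    IsRestr F (r ∷ rs) α S₁ × IsRestr F (r ∷ rs) β S₂ ×
    ((+ length (select (r ∷ rs) S₂)) ℚ./ suc (length rs)
       ℚ.< (+ length (select (r ∷ rs) S₁)) ℚ./ suc (length rs))
  satP F rows (φ ∧ᵖ ψ) = satP F rows φ × satP F rows ψ
  satP F rows (φ ⊔ ψ)  = satP F rows φ Data.Sum.⊎ satP F rows ψ
    where import Data.Sum
  satP F rows (α ⊃ᵖ φ) = Σ (Sub rows) λ S → IsRestr F rows α S × satP F (select rows S) φ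
  satP F rows (ι □→ᵖ φ) = satP (intF F ι) (map (intRow F ι) rows) φ

  _⊨_ : CausalMultiteam → PCO → Set
  T ⊨ φ = satP (CausalMultiteam.F T) (CausalMultiteam.rows T) φ

  _ᶜ : PCO → PCO
  lit= Y y ᶜ    = Pr< (Y ≐ y) ε1
  lit≠ Y y ᶜ    = Pr< (Y ≠̇ y) ε1
  Pr≥ α ε ᶜ     = Pr< α ε
  Pr> α ε ᶜ     = Pr≤ α ε
  Pr≥Pr α β ᶜ   = Pr>Pr β α
  Pr>Pr α β ᶜ   = Pr≥Pr β α
  (φ ∧ᵖ ψ) ᶜ    = (φ ᶜ) ⊔ (ψ ᶜ)
  (φ ⊔ ψ) ᶜ     = (φ ᶜ) ∧ᵖ (ψ ᶜ)
  (α ⊃ᵖ φ) ᶜ    = Pr> α ε0 ∧ᵖ (α ⊃ᵖ (φ ᶜ))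
  (ι □→ᵖ φ) ᶜ   = ι □→ᵖ (φ ᶜ)

{-# OPTIONS --safe #-}
-- CO formulas are flat (a team satisfies α iff each of its rows does) and classical on a
-- single row, so T^α is the sublist of rows satisfying α, P_T(α) is a ratio of counts, and
-- P_T(¬α) = 1 − P_T(α).  Every probabilistic atom therefore amounts to an inequality
-- between natural numbers, and ᶜ replaces it by the negated inequality.  The connectives
-- follow by induction on φ, using that ⊨ is decidable for ∧; for α ⊃ φ the extra
-- conjunct Pr(α) > 0 excludes an empty T^α, which would satisfy every formula.
module Submission where

open import Data.Bool using (Bool; true; false; T; not; _∧_; _∨_)
open import Data.Bool.Properties using (T-≡; T-∧; T-∨; not-involutive; ∨-∧-booleanAlgebra)
open import Algebra.Lattice.Properties.BooleanAlgebra ∨-∧-booleanAlgebra using (deMorgan₁; deMorgan₂)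
open import Data.Fin using (zero; suc; _≟_)
open import Data.Integer as ℤ using (+_; +≤+; +<+)
open import Data.Integer.Properties using (pos-*; drop‿+≤+; drop‿+<+)
open import Data.List using (List; []; _∷_; [_]; length; lookup; map; filter; filterᵇ)
open import Data.List.Properties
  using (filter-accept; filter-reject; filter-none; length-filter; tabulate-lookup)
open import Data.List.Relation.Unary.All as All using (All; []; _∷_)
open import Data.List.Relation.Unary.All.Properties
  using (tabulate⁺; tabulate⁻; all-filter; filter⁺; filter⁻; singleton⁻; map⁺; map⁻)
open import Data.Nat as ℕ using (ℕ; suc; _+_; _*_; _∸_; _≤_; _<_)
open import Data.Nat.Properties
  using ( ∸-cancelʳ-<; ∸-cancelʳ-≤; ∸-monoʳ-<; ∸-monoʳ-≤; <⇒≱; ≰⇒>; ≤⇒≯; ≮⇒≥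
        ; *-distribʳ-∸; *-comm; *-monoˡ-≤; *-identityʳ; ≤-trans; ≤-reflexive
        ; m+n∸n≡m; +-suc; _≤?_; _<?_)
open import Data.Product using (Σ; _×_; _,_; proj₁; proj₂)
open import Data.Product.Function.NonDependent.Propositional using (_×-⇔_)
open import Data.Rational as ℚ using (fromℚᵘ)
open import Data.Rational.Properties
  using (toℚᵘ-fromℚᵘ; toℚᵘ-mono-≤; toℚᵘ-cancel-≤; toℚᵘ-mono-<; toℚᵘ-cancel-<)
open import Data.Rational.Unnormalised as ℚᵘ using (mkℚᵘ; *≤*; *<*)
import Data.Rational.Unnormalised.Properties as ℚᵘ
open import Data.Sum as Sum using (_⊎_; inj₁; inj₂)
open import Data.Sum.Function.Propositional using (_⊎-⇔_)
open import Data.Unit using (tt)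
open import Function using (_⇔_; mk⇔; Equivalence; _∘_; id; const; case_of_)
import Function.Properties.Equivalence as ⇔
open import Function.Related.TypeIsomorphisms using (¬-cong-⇔)
open import Level using (0ℓ)
open import Relation.Binary.PropositionalEquality
  using (_≡_; _≢_; refl; sym; trans; cong; cong₂; subst; subst₂; module ≡-Reasoning)
import Relation.Binary.Reasoning.Setoid as SetoidReasoning
open import Relation.Nullary using (¬_; Dec; yes; no; ¬?; contradiction; _¬-⊎_)
open import Relation.Nullary.Decidable as Dec
  using (⌊_⌋; T?; toWitness; fromWitness; toWitnessFalse; fromWitnessFalse; _×-dec_; _⊎-dec_)
open import Relation.Unary using (Pred; Decidable; ∁)

open import Defs

open Equivalence using (to; from)
open Eps using (num; den-1; bound)

module ⇔-Reasoning = SetoidReasoning (⇔.⇔-setoid 0ℓ)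

module _ {A : Set} {P : Pred A 0ℓ} where

  All-lookup-⇔ : (xs : List A) → All P xs ⇔ (∀ i → P (lookup xs i))
  All-lookup-⇔ xs = mk⇔
    (λ ps → tabulate⁻ (subst (All P) (sym (tabulate-lookup xs)) ps))
    (λ ps → subst (All P) (tabulate-lookup xs) (tabulate⁺ ps))

  All-select⁻ : ∀ xs S → All P (select xs S) → ∀ i → T (S i) → P (lookup xs i)
  All-select⁻ (x ∷ xs) S ps zero t with S zero | ps
  ... | true | px ∷ _ = px
  All-select⁻ (x ∷ xs) S ps (suc i) t with S zero | ps
  ... | true  | _ ∷ ps′ = All-select⁻ xs (S ∘ suc) ps′ i t
  ... | false | ps′     = All-select⁻ xs (S ∘ suc) ps′ i t

  All-select⁺ : ∀ xs S → (∀ i → T (S i) → P (lookup xs i)) → All P (select xs S)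
  All-select⁺ []       S ps = []
  All-select⁺ (x ∷ xs) S ps with S zero | ps zero
  ... | true  | px = px tt ∷ All-select⁺ xs (S ∘ suc) (ps ∘ suc)
  ... | false | _  = All-select⁺ xs (S ∘ suc) (ps ∘ suc)

  module _ (P? : Decidable P) where

    select≡filter : ∀ xs S → (∀ i → T (S i) ⇔ P (lookup xs i)) → select xs S ≡ filter P? xs
    select≡filter []       S _   = refl
    select≡filter (x ∷ xs) S S⇔P with S zero | S⇔P zero
    ... | true  | S₀⇔Px = trans (cong (x ∷_) (select≡filter xs (S ∘ suc) (S⇔P ∘ suc)))
                                (sym (filter-accept P? (to S₀⇔Px tt)))
    ... | false | S₀⇔Px = trans (select≡filter xs (S ∘ suc) (S⇔P ∘ suc))
                                (sym (filter-reject P? (from S₀⇔Px)))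

    filter≡[]-⇔ : ∀ xs → filter P? xs ≡ [] ⇔ All (∁ P) xs
    filter≡[]-⇔ xs = mk⇔ (filter≡[]⇒All∁ xs) (filter-none P?)
      where
      filter≡[]⇒All∁ : ∀ xs → filter P? xs ≡ [] → All (∁ P) xs
      filter≡[]⇒All∁ []       _  = []
      filter≡[]⇒All∁ (x ∷ xs) eq with P? x | eq
      ... | yes _  | ()
      ... | no ¬px | eq′ = ¬px ∷ filter≡[]⇒All∁ xs eq′

    All-filter-⇔ : ∀ {Q : Pred A 0ℓ} xs → All Q (filter P? xs) ⇔ All (λ x → P x → Q x) xs
    All-filter-⇔ xs = mk⇔
      (λ qs → filter⁻ P? (All.map const qs)
                (All.map (λ ¬px px → contradiction px ¬px) (all-filter (¬? ∘ P?) xs)))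
      (λ qs → All.zipWith (λ (q , p) → q p) (filter⁺ P? qs , all-filter P? xs))

module _ {A : Set} where

  All-cong : ∀ {P Q : Pred A 0ℓ} {xs} → (∀ {x} → P x ⇔ Q x) → All P xs ⇔ All Q xs
  All-cong P⇔Q = mk⇔ (All.map (to P⇔Q)) (All.map (from P⇔Q))

  All-×-⇔ : ∀ {P Q : Pred A 0ℓ} {xs} → (All P xs × All Q xs) ⇔ All (λ x → P x × Q x) xs
  All-×-⇔ = mk⇔ All.zip All.unzip

  0<length-⇔ : ∀ {xs : List A} → 0 < length xs ⇔ xs ≢ []
  0<length-⇔ {[]}    = mk⇔ (λ ()) (λ []≢[] → contradiction refl []≢[])
  0<length-⇔ {_ ∷ _} = mk⇔ (λ _ ()) (λ _ → ℕ.s≤s ℕ.z≤n)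

  length-filterᵇ-complement : ∀ {p q : A → Bool} → (∀ x → q x ≡ not (p x)) → ∀ xs →
                              length (filterᵇ q xs) + length (filterᵇ p xs) ≡ length xs
  length-filterᵇ-complement         q≡¬p []       = refl
  length-filterᵇ-complement {p} {q} q≡¬p (x ∷ xs) rewrite q≡¬p x with p x
  ... | true  = trans (+-suc _ _) (cong suc (length-filterᵇ-complement q≡¬p xs))
  ... | false = cong suc (length-filterᵇ-complement q≡¬p xs)

T-⊃ : ∀ {a b} → T (not a ∨ b) ⇔ (T a → T b)
T-⊃ {true}  = mk⇔ const (λ f → f tt)
T-⊃ {false} = mk⇔ (λ _ ()) (const tt)

¬T-not-⇔ : ∀ {a} → (¬ T (not a)) ⇔ T a
¬T-not-⇔ {true}  = mk⇔ (const tt) (λ _ ())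
¬T-not-⇔ {false} = mk⇔ (λ ¬t → ¬t tt) (λ ())

¬⊎¬-⇔-¬× : ∀ {A B : Set} → Dec A → (¬ A ⊎ ¬ B) ⇔ (¬ (A × B))
¬⊎¬-⇔-¬× A? = mk⇔ (λ { (inj₁ ¬a) (a , _) → ¬a a ; (inj₂ ¬b) (_ , b) → ¬b b })
                  (λ ¬ab → case A? of λ { (yes a) → inj₂ (λ b → ¬ab (a , b))
                                        ; (no ¬a) → inj₁ ¬a })

¬×¬-⇔-¬⊎ : ∀ {A B : Set} → (¬ A × ¬ B) ⇔ (¬ (A ⊎ B))
¬×¬-⇔-¬⊎ = mk⇔ (λ (¬a , ¬b) → ¬a ¬-⊎ ¬b) (λ ¬a⊎b → ¬a⊎b ∘ inj₁ , ¬a⊎b ∘ inj₂)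

<⇔≱ : ∀ {m n} → m < n ⇔ (¬ n ≤ m)
<⇔≱ = mk⇔ <⇒≱ ≰⇒>

≤⇔≯ : ∀ {m n} → m ≤ n ⇔ (¬ n < m)
≤⇔≯ = mk⇔ ≤⇒≯ ≮⇒≥

∸-<-∸-⇔ : ∀ {M x y} → x ≤ M → (M ∸ x < M ∸ y) ⇔ (y < x)
∸-<-∸-⇔ x≤M = mk⇔ ∸-cancelʳ-< (λ y<x → ∸-monoʳ-< y<x x≤M)

∸-≤-∸-⇔ : ∀ {M x y} → y ≤ M → (M ∸ x ≤ M ∸ y) ⇔ (y ≤ x)
∸-≤-∸-⇔ {M} y≤M = mk⇔ (∸-cancelʳ-≤ y≤M) (∸-monoʳ-≤ M)

module Complement {a D c N : ℕ} (a≤D : a ≤ D) (c≤N : c ≤ N) where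
  private
    aN≤DN : a * N ≤ D * N
    aN≤DN = *-monoˡ-≤ N a≤D

    cD≤DN : c * D ≤ D * N
    cD≤DN = ≤-trans (*-monoˡ-≤ D c≤N) (≤-reflexive (*-comm N D))

    [D∸a]N≡ : (D ∸ a) * N ≡ D * N ∸ a * N
    [D∸a]N≡ = *-distribʳ-∸ N D a

    [N∸c]D≡ : (N ∸ c) * D ≡ D * N ∸ c * D
    [N∸c]D≡ = trans (*-distribʳ-∸ D N c) (cong (_∸ c * D) (*-comm N D))

  complement-<-⇔ : (D ∸ a) * N < (N ∸ c) * D ⇔ (¬ a * N ≤ c * D)
  complement-<-⇔ = begin
    (D ∸ a) * N < (N ∸ c) * D     ≡⟨ cong₂ _<_ [D∸a]N≡ [N∸c]D≡ ⟩
    D * N ∸ a * N < D * N ∸ c * D  ≈⟨ ∸-<-∸-⇔ aN≤DN ⟩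
    c * D < a * N                  ≈⟨ <⇔≱ ⟩
    (¬ a * N ≤ c * D)              ∎
    where open ⇔-Reasoning

  complement-≤-⇔ : (D ∸ a) * N ≤ (N ∸ c) * D ⇔ (¬ a * N < c * D)
  complement-≤-⇔ = begin
    (D ∸ a) * N ≤ (N ∸ c) * D      ≡⟨ cong₂ _≤_ [D∸a]N≡ [N∸c]D≡ ⟩
    D * N ∸ a * N ≤ D * N ∸ c * D  ≈⟨ ∸-≤-∸-⇔ cD≤DN ⟩
    c * D ≤ a * N                  ≈⟨ ≤⇔≯ ⟩
    (¬ a * N < c * D)              ∎
    where open ⇔-Reasoning

fromℚᵘ-≤-⇔ : ∀ p q → fromℚᵘ p ℚ.≤ fromℚᵘ q ⇔ p ℚᵘ.≤ q
fromℚᵘ-≤-⇔ p q = mk⇔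
  (λ h → ℚᵘ.≤-respʳ-≃ q≃ (ℚᵘ.≤-respˡ-≃ p≃ (toℚᵘ-mono-≤ h)))
  (λ h → toℚᵘ-cancel-≤ (ℚᵘ.≤-respʳ-≃ (ℚᵘ.≃-sym q≃) (ℚᵘ.≤-respˡ-≃ (ℚᵘ.≃-sym p≃) h)))
  where p≃ = toℚᵘ-fromℚᵘ p
        q≃ = toℚᵘ-fromℚᵘ q

fromℚᵘ-<-⇔ : ∀ p q → fromℚᵘ p ℚ.< fromℚᵘ q ⇔ p ℚᵘ.< q
fromℚᵘ-<-⇔ p q = mk⇔
  (λ h → ℚᵘ.<-respʳ-≃ q≃ (ℚᵘ.<-respˡ-≃ p≃ (toℚᵘ-mono-< h)))
  (λ h → toℚᵘ-cancel-< (ℚᵘ.<-respʳ-≃ (ℚᵘ.≃-sym q≃) (ℚᵘ.<-respˡ-≃ (ℚᵘ.≃-sym p≃) h)))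
  where p≃ = toℚᵘ-fromℚᵘ p
        q≃ = toℚᵘ-fromℚᵘ q

mkℚᵘ-≤-⇔ : ∀ a d b e → mkℚᵘ (+ a) d ℚᵘ.≤ mkℚᵘ (+ b) e ⇔ a * suc e ≤ b * suc d
mkℚᵘ-≤-⇔ a d b e = mk⇔
  (λ { (*≤* q) → drop‿+≤+ (subst₂ ℤ._≤_ (sym ae) (sym bd) q) })
  (λ q → *≤* (subst₂ ℤ._≤_ ae bd (+≤+ q)))
  where ae = pos-* a (suc e)
        bd = pos-* b (suc d)

mkℚᵘ-<-⇔ : ∀ a d b e → mkℚᵘ (+ a) d ℚᵘ.< mkℚᵘ (+ b) e ⇔ a * suc e < b * suc d
mkℚᵘ-<-⇔ a d b e = mk⇔
  (λ { (*<* q) → drop‿+<+ (subst₂ ℤ._<_ (sym ae) (sym bd) q) })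
  (λ q → *<* (subst₂ ℤ._<_ ae bd (+<+ q)))
  where ae = pos-* a (suc e)
        bd = pos-* b (suc d)

/-≤-/-⇔ : ∀ a d b e → (+ a) ℚ./ suc d ℚ.≤ (+ b) ℚ./ suc e ⇔ a * suc e ≤ b * suc d
/-≤-/-⇔ a d b e = ⇔.trans (fromℚᵘ-≤-⇔ (mkℚᵘ (+ a) d) (mkℚᵘ (+ b) e)) (mkℚᵘ-≤-⇔ a d b e)

/-<-/-⇔ : ∀ a d b e → (+ a) ℚ./ suc d ℚ.< (+ b) ℚ./ suc e ⇔ a * suc e < b * suc d
/-<-/-⇔ a d b e = ⇔.trans (fromℚᵘ-<-⇔ (mkℚᵘ (+ a) d) (mkℚᵘ (+ b) e)) (mkℚᵘ-<-⇔ a d b e)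

module CausalProperties (σ : Signature) where
  open Causal σ

  holds : FunComp → CO → Assign → Bool
  holds F (Y ≐ y)  s = ⌊ s Y ≟ y ⌋
  holds F (Y ≠̇ y)  s = not ⌊ s Y ≟ y ⌋
  holds F (α ∧̇ β)  s = holds F α s ∧ holds F β s
  holds F (α ∨̇ β)  s = holds F α s ∨ holds F β s
  holds F (α ⊃̇ β)  s = not (holds F α s) ∨ holds F β s
  holds F (ι □→ α) s = holds (intF F ι) α (intRow F ι s)

  Holds : FunComp → CO → Pred Assign 0ℓ
  Holds F α = T ∘ holds F α

  holds-¬̇ : ∀ F α s → holds F (¬̇ α) s ≡ not (holds F α s)
  holds-¬̇ F (Y ≐ y)  s = refl
  holds-¬̇ F (Y ≠̇ y)  s = sym (not-involutive _)
  holds-¬̇ F (α ∧̇ β)  s =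
    trans (cong₂ _∨_ (holds-¬̇ F α s) (holds-¬̇ F β s)) (sym (deMorgan₁ (holds F α s) (holds F β s)))
  holds-¬̇ F (α ∨̇ β)  s =
    trans (cong₂ _∧_ (holds-¬̇ F α s) (holds-¬̇ F β s)) (sym (deMorgan₂ (holds F α s) (holds F β s)))
  holds-¬̇ F (α ⊃̇ β)  s = begin
    a ∧ holds F (¬̇ β) s  ≡⟨ cong₂ _∧_ (sym (not-involutive a)) (holds-¬̇ F β s) ⟩
    not (not a) ∧ not b  ≡⟨ deMorgan₂ (not a) b ⟨
    not (not a ∨ b)      ∎
    where open ≡-Reasoning
          a = holds F α s
          b = holds F β s
  holds-¬̇ F (ι □→ α) s = holds-¬̇ (intF F ι) α (intRow F ι s)

  ¬Holds-¬̇-⇔ : ∀ {F α s} → (¬ Holds F (¬̇ α) s) ⇔ Holds F α s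
  ¬Holds-¬̇-⇔ {F} {α} {s} rewrite holds-¬̇ F α s = ¬T-not-⇔

  keys : FunComp → CO → (rows : List Assign) → Sub rows
  keys F α rows i = holds F α (lookup rows i)

  restrict : FunComp → CO → List Assign → List Assign
  restrict F α = filterᵇ (holds F α)

  count : FunComp → CO → List Assign → ℕ
  count F α rows = length (restrict F α rows)

  count≤length : ∀ F α rows → count F α rows ≤ length rows
  count≤length F α = length-filter (T? ∘ holds F α)

  count-¬̇ : ∀ F α rows → count F (¬̇ α) rows ≡ length rows ∸ count F α rows
  count-¬̇ F α rows = trans (sym (m+n∸n≡m _ (count F α rows)))
    (cong (_∸ count F α rows) (length-filterᵇ-complement (holds-¬̇ F α) rows))

  -- Parameterised by flatness on singletons so that the ⊃̇ case of satCO-flat can use it.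
  module Restriction {F : FunComp} {α : CO}
                     (singleton-flat : ∀ s → satCO F [ s ] α ⇔ Holds F α s) where

    isRestr-keys : ∀ rows → IsRestr F rows α (keys F α rows)
    isRestr-keys rows i = from (singleton-flat (lookup rows i)) ∘ from T-≡
                        , to T-≡ ∘ to (singleton-flat (lookup rows i))

    isRestr⇒select≡restrict : ∀ rows S → IsRestr F rows α S → select rows S ≡ restrict F α rows
    isRestr⇒select≡restrict rows S R = select≡filter (T? ∘ holds F α) rows S λ i →
      ⇔.trans (⇔.trans T-≡ (mk⇔ (proj₁ (R i)) (proj₂ (R i)))) (singleton-flat (lookup rows i))

    restriction-⇔ : ∀ rows (P : List Assign → Set) →
                    (Σ (Sub rows) λ S → IsRestr F rows α S × P (select rows S)) ⇔ P (restrict F α rows)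
    restriction-⇔ rows P = mk⇔
      (λ (S , R , p) → subst P (isRestr⇒select≡restrict rows S R) p)
      (λ p → keys F α rows , isRestr-keys rows ,
             subst P (sym (isRestr⇒select≡restrict rows _ (isRestr-keys rows))) p)

  satCO-flat : ∀ F rows α → satCO F rows α ⇔ All (Holds F α) rows
  satCO-singleton : ∀ F α s → satCO F [ s ] α ⇔ Holds F α s

  satCO-singleton F α s = ⇔.trans (satCO-flat F [ s ] α) (mk⇔ singleton⁻ (_∷ []))

  satCO-flat F rows (Y ≐ y)  = All-cong (mk⇔ fromWitness toWitness)
  satCO-flat F rows (Y ≠̇ y)  = All-cong (mk⇔ fromWitnessFalse toWitnessFalse)
  satCO-flat F rows (α ∧̇ β)  =
    ⇔.trans (satCO-flat F rows α ×-⇔ satCO-flat F rows β) (⇔.trans All-×-⇔ (All-cong (⇔.sym T-∧)))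
  satCO-flat F rows (α ∨̇ β)  = mk⇔ split join
    where
    split : satCO F rows (α ∨̇ β) → All (Holds F (α ∨̇ β)) rows
    split (S₁ , S₂ , cover , p , q) = from (All-lookup-⇔ rows) λ i →
      from T-∨ (Sum.map (All-select⁻ rows S₁ (to (satCO-flat F _ α) p) i)
                        (All-select⁻ rows S₂ (to (satCO-flat F _ β) q) i)
                        (to T-∨ (from T-≡ (cover i))))
    join : All (Holds F (α ∨̇ β)) rows → satCO F rows (α ∨̇ β)
    join h = keys F α rows , keys F β rows , to T-≡ ∘ to (All-lookup-⇔ rows) h ,
             from (satCO-flat F _ α) (All-select⁺ rows _ (λ _ → id)) ,
             from (satCO-flat F _ β) (All-select⁺ rows _ (λ _ → id))
  satCO-flat F rows (α ⊃̇ β)  = begin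
    satCO F rows (α ⊃̇ β)                      ≈⟨ restriction-⇔ rows (λ rows′ → satCO F rows′ β) ⟩
    satCO F (restrict F α rows) β              ≈⟨ satCO-flat F _ β ⟩
    All (Holds F β) (restrict F α rows)        ≈⟨ All-filter-⇔ (T? ∘ holds F α) rows ⟩
    All (λ s → Holds F α s → Holds F β s) rows ≈⟨ All-cong T-⊃ ⟨
    All (Holds F (α ⊃̇ β)) rows                 ∎
    where open ⇔-Reasoning
          open Restriction {F} {α} (satCO-singleton F α)
  satCO-flat F rows (ι □→ α) =
    ⇔.trans (satCO-flat (intF F ι) (map (intRow F ι) rows) α) (mk⇔ map⁻ map⁺)

  module Restricted (F : FunComp) (α : CO) = Restriction {F} {α} (satCO-singleton F α)

  restriction₂-⇔ : ∀ F α β rows (Q : List Assign → List Assign → Set) →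
    (Σ (Sub rows) λ S₁ → Σ (Sub rows) λ S₂ →
       IsRestr F rows α S₁ × IsRestr F rows β S₂ × Q (select rows S₁) (select rows S₂))
    ⇔ Q (restrict F α rows) (restrict F β rows)
  restriction₂-⇔ F α β rows Q = mk⇔
    (λ (S₁ , S₂ , R₁ , R₂ , q) → subst₂ Q (α.isRestr⇒select≡restrict rows S₁ R₁)
                                          (β.isRestr⇒select≡restrict rows S₂ R₂) q)
    (λ q → keys F α rows , keys F β rows , α.isRestr-keys rows , β.isRestr-keys rows ,
           subst₂ Q (sym (α.isRestr⇒select≡restrict rows _ (α.isRestr-keys rows)))
                    (sym (β.isRestr⇒select≡restrict rows _ (β.isRestr-keys rows))) q)
    where module α = Restricted F α
          module β = Restricted F β

  ⊃ᵖ-⇔ : ∀ F rows α φ → satP F rows (α ⊃ᵖ φ) ⇔ satP F (restrict F α rows) φ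
  ⊃ᵖ-⇔ F rows α φ = Restricted.restriction-⇔ F α rows (λ rows′ → satP F rows′ φ)

  satP-[] : ∀ F φ → satP F [] φ
  satP-[] F (lit= Y y)  = []
  satP-[] F (lit≠ Y y)  = []
  satP-[] F (Pr≥ α ε)   = tt
  satP-[] F (Pr> α ε)   = tt
  satP-[] F (Pr≥Pr α β) = tt
  satP-[] F (Pr>Pr α β) = tt
  satP-[] F (φ ∧ᵖ ψ)    = satP-[] F φ , satP-[] F ψ
  satP-[] F (φ ⊔ ψ)     = inj₁ (satP-[] F φ)
  satP-[] F (α ⊃ᵖ φ)    = (λ ()) , (λ ()) , satP-[] F φ
  satP-[] F (ι □→ᵖ φ)   = satP-[] (intF F ι) φ

  module Atoms (F : FunComp) (r : Assign) (rs : List Assign) where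
    private
      rows = r ∷ rs
      N = length rows

    Pr≥-⇔ : ∀ α ε → satP F rows (Pr≥ α ε) ⇔ num ε * N ≤ count F α rows * suc (den-1 ε)
    Pr≥-⇔ α ε = ⇔.trans (Restricted.restriction-⇔ F α rows (λ rows′ → valε ε ℚ.≤ (+ length rows′) ℚ./ N))
                        (/-≤-/-⇔ (num ε) (den-1 ε) (count F α rows) (length rs))

    Pr>-⇔ : ∀ α ε → satP F rows (Pr> α ε) ⇔ num ε * N < count F α rows * suc (den-1 ε)
    Pr>-⇔ α ε = ⇔.trans (Restricted.restriction-⇔ F α rows (λ rows′ → valε ε ℚ.< (+ length rows′) ℚ./ N))
                        (/-<-/-⇔ (num ε) (den-1 ε) (count F α rows) (length rs))

    Pr≥Pr-⇔ : ∀ α β → satP F rows (Pr≥Pr α β) ⇔ count F β rows * N ≤ count F α rows * N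
    Pr≥Pr-⇔ α β = ⇔.trans
      (restriction₂-⇔ F α β rows (λ rowsα rowsβ → (+ length rowsβ) ℚ./ N ℚ.≤ (+ length rowsα) ℚ./ N))
      (/-≤-/-⇔ (count F β rows) (length rs) (count F α rows) (length rs))

    Pr>Pr-⇔ : ∀ α β → satP F rows (Pr>Pr α β) ⇔ count F β rows * N < count F α rows * N
    Pr>Pr-⇔ α β = ⇔.trans
      (restriction₂-⇔ F α β rows (λ rowsα rowsβ → (+ length rowsβ) ℚ./ N ℚ.< (+ length rowsα) ℚ./ N))
      (/-<-/-⇔ (count F β rows) (length rs) (count F α rows) (length rs))

    Pr<-⇔ : ∀ α ε → satP F rows (Pr< α ε) ⇔
                    num (one-minus ε) * N < (N ∸ count F α rows) * suc (den-1 ε)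
    Pr<-⇔ α ε = subst (λ c → satP F rows (Pr< α ε) ⇔ num (one-minus ε) * N < c * suc (den-1 ε))
                      (count-¬̇ F α rows) (Pr>-⇔ (¬̇ α) (one-minus ε))

    Pr≤-⇔ : ∀ α ε → satP F rows (Pr≤ α ε) ⇔
                    num (one-minus ε) * N ≤ (N ∸ count F α rows) * suc (den-1 ε)
    Pr≤-⇔ α ε = subst (λ c → satP F rows (Pr≤ α ε) ⇔ num (one-minus ε) * N ≤ c * suc (den-1 ε))
                      (count-¬̇ F α rows) (Pr≥-⇔ (¬̇ α) (one-minus ε))

    Pr<-⇔-¬Pr≥ : ∀ α ε → satP F rows (Pr< α ε) ⇔ (¬ satP F rows (Pr≥ α ε))
    Pr<-⇔-¬Pr≥ α ε =
      ⇔.trans (Pr<-⇔ α ε) (⇔.trans (Complement.complement-<-⇔ (bound ε) (count≤length F α rows))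
                                   (¬-cong-⇔ (⇔.sym (Pr≥-⇔ α ε))))

    Pr≤-⇔-¬Pr> : ∀ α ε → satP F rows (Pr≤ α ε) ⇔ (¬ satP F rows (Pr> α ε))
    Pr≤-⇔-¬Pr> α ε =
      ⇔.trans (Pr≤-⇔ α ε) (⇔.trans (Complement.complement-≤-⇔ (bound ε) (count≤length F α rows))
                                   (¬-cong-⇔ (⇔.sym (Pr>-⇔ α ε))))

    Pr>Pr-⇔-¬Pr≥Pr : ∀ α β → satP F rows (Pr>Pr β α) ⇔ (¬ satP F rows (Pr≥Pr α β))
    Pr>Pr-⇔-¬Pr≥Pr α β = ⇔.trans (Pr>Pr-⇔ β α) (⇔.trans <⇔≱ (¬-cong-⇔ (⇔.sym (Pr≥Pr-⇔ α β))))

    Pr≥Pr-⇔-¬Pr>Pr : ∀ α β → satP F rows (Pr≥Pr β α) ⇔ (¬ satP F rows (Pr>Pr α β))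
    Pr≥Pr-⇔-¬Pr>Pr α β = ⇔.trans (Pr≥Pr-⇔ β α) (⇔.trans ≤⇔≯ (¬-cong-⇔ (⇔.sym (Pr>Pr-⇔ α β))))

    Pr>0-⇔ : ∀ α → satP F rows (Pr> α ε0) ⇔ restrict F α rows ≢ []
    Pr>0-⇔ α = begin
      satP F rows (Pr> α ε0)  ≈⟨ Pr>-⇔ α ε0 ⟩
      0 < count F α rows * 1  ≡⟨ cong (0 <_) (*-identityʳ _) ⟩
      0 < count F α rows      ≈⟨ 0<length-⇔ ⟩
      restrict F α rows ≢ []  ∎
      where open ⇔-Reasoning

    Pr>0-¬̇-⇔ : ∀ α → satP F rows (Pr> (¬̇ α) ε0) ⇔ (¬ satCO F rows α)
    Pr>0-¬̇-⇔ α = begin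
      satP F rows (Pr> (¬̇ α) ε0)            ≈⟨ Pr>0-⇔ (¬̇ α) ⟩
      restrict F (¬̇ α) rows ≢ []            ≈⟨ ¬-cong-⇔ (filter≡[]-⇔ (T? ∘ holds F (¬̇ α)) rows) ⟩
      (¬ All (∁ (Holds F (¬̇ α))) rows)      ≈⟨ ¬-cong-⇔ (All-cong (¬Holds-¬̇-⇔ {F} {α})) ⟩
      (¬ All (Holds F α) rows)               ≈⟨ ¬-cong-⇔ (satCO-flat F rows α) ⟨
      (¬ satCO F rows α)                     ∎
      where open ⇔-Reasoning

  satP? : ∀ F rows φ → Dec (satP F rows φ)
  satP? F []       φ           = yes (satP-[] F φ)
  satP? F (r ∷ rs) (lit= Y y)  = All.all? (λ s → s Y ≟ y) (r ∷ rs)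
  satP? F (r ∷ rs) (lit≠ Y y)  = All.all? (λ s → ¬? (s Y ≟ y)) (r ∷ rs)
  satP? F (r ∷ rs) (Pr≥ α ε)   = Dec.map (⇔.sym (Atoms.Pr≥-⇔ F r rs α ε)) (_ ≤? _)
  satP? F (r ∷ rs) (Pr> α ε)   = Dec.map (⇔.sym (Atoms.Pr>-⇔ F r rs α ε)) (_ <? _)
  satP? F (r ∷ rs) (Pr≥Pr α β) = Dec.map (⇔.sym (Atoms.Pr≥Pr-⇔ F r rs α β)) (_ ≤? _)
  satP? F (r ∷ rs) (Pr>Pr α β) = Dec.map (⇔.sym (Atoms.Pr>Pr-⇔ F r rs α β)) (_ <? _)
  satP? F rows     (φ ∧ᵖ ψ)    = satP? F rows φ ×-dec satP? F rows ψ
  satP? F rows     (φ ⊔ ψ)     = satP? F rows φ ⊎-dec satP? F rows ψ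
  satP? F rows     (α ⊃ᵖ φ)    = Dec.map (⇔.sym (⊃ᵖ-⇔ F rows α φ)) (satP? F (restrict F α rows) φ)
  satP? F rows     (ι □→ᵖ φ)   = satP? (intF F ι) (map (intRow F ι) rows) φ

  satP-ᶜ : ∀ F rows → rows ≢ [] → ∀ φ → satP F rows (φ ᶜ) ⇔ (¬ satP F rows φ)
  ≢[]×satP-ᶜ-⇔ : ∀ F rows φ → (rows ≢ [] × satP F rows (φ ᶜ)) ⇔ (¬ satP F rows φ)

  ≢[]×satP-ᶜ-⇔ F rows φ = mk⇔
    (λ (rows≢[] , φᶜ) → to (satP-ᶜ F rows rows≢[] φ) φᶜ)
    (λ ¬φ → let rows≢[] = λ { refl → ¬φ (satP-[] F φ) }
            in rows≢[] , from (satP-ᶜ F rows rows≢[] φ) ¬φ)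

  satP-ᶜ F []       []≢[] φ = contradiction refl []≢[]
  -- (lit= Y y) ᶜ is Pr(Y ≠̇ y) > 1 − 1, and valε (one-minus ε1) reduces to valε ε0.
  satP-ᶜ F (r ∷ rs) _ (lit= Y y)  = Atoms.Pr>0-¬̇-⇔ F r rs (Y ≐ y)
  satP-ᶜ F (r ∷ rs) _ (lit≠ Y y)  = Atoms.Pr>0-¬̇-⇔ F r rs (Y ≠̇ y)
  satP-ᶜ F (r ∷ rs) _ (Pr≥ α ε)   = Atoms.Pr<-⇔-¬Pr≥ F r rs α ε
  satP-ᶜ F (r ∷ rs) _ (Pr> α ε)   = Atoms.Pr≤-⇔-¬Pr> F r rs α ε
  satP-ᶜ F (r ∷ rs) _ (Pr≥Pr α β) = Atoms.Pr>Pr-⇔-¬Pr≥Pr F r rs α β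
  satP-ᶜ F (r ∷ rs) _ (Pr>Pr α β) = Atoms.Pr≥Pr-⇔-¬Pr>Pr F r rs α β
  satP-ᶜ F rows rows≢[] (φ ∧ᵖ ψ) =
    ⇔.trans (satP-ᶜ F rows rows≢[] φ ⊎-⇔ satP-ᶜ F rows rows≢[] ψ) (¬⊎¬-⇔-¬× (satP? F rows φ))
  satP-ᶜ F rows rows≢[] (φ ⊔ ψ) =
    ⇔.trans (satP-ᶜ F rows rows≢[] φ ×-⇔ satP-ᶜ F rows rows≢[] ψ) ¬×¬-⇔-¬⊎
  satP-ᶜ F (r ∷ rs) _ (α ⊃ᵖ φ) = begin
    (satP F rows (Pr> α ε0) × satP F rows (α ⊃ᵖ (φ ᶜ)))          ≈⟨ Atoms.Pr>0-⇔ F r rs α ×-⇔ ⊃ᵖ-⇔ F rows α (φ ᶜ) ⟩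
    (restrict F α rows ≢ [] × satP F (restrict F α rows) (φ ᶜ))  ≈⟨ ≢[]×satP-ᶜ-⇔ F (restrict F α rows) φ ⟩
    (¬ satP F (restrict F α rows) φ)                              ≈⟨ ¬-cong-⇔ (⊃ᵖ-⇔ F rows α φ) ⟨
    (¬ satP F rows (α ⊃ᵖ φ))                                      ∎
    where open ⇔-Reasoning
          rows = r ∷ rs
  satP-ᶜ F (r ∷ rs) _ (ι □→ᵖ φ) = satP-ᶜ (intF F ι) (map (intRow F ι) (r ∷ rs)) (λ ()) φ

mainTheorem1 : (σ : Signature) → let open Causal σ in
    (T : CausalMultiteam) → Recursive (CausalMultiteam.F T) → NonEmpty T →
    (φ : PCO) → (T ⊨ (φ ᶜ)) ⇔ (¬ (T ⊨ φ))
mainTheorem1 σ T _ T≢∅ = CausalProperties.satP-ᶜ σ F rows T≢∅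
  where open Causal.CausalMultiteam {σ} T
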